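{- Let $n$ be a positive integer and let $E_O(n)=\{(a,b)\in E^H(n): \Omega(a)\text{ is odd}\}$. Then $|E_O(n)|=\lfloor |E^H(n)|/2\rfloor$.
   Context: $V(n)$ is the set of positive divisors of $n$; $\Omega(a)$ is the number of prime factors of $a$ counted with multiplicity. $E^H(n)$ is the arc set of the Hasse diagram of $n$: the pairs $(a,b)$ with $a,b\in V(n)$, $a<b$, $a\mid b$, such that there is no $c\in V(n)$ with $a<c<b$, $a\mid c$, $c\mid b$. -}

module Defs where

open import Data.Nat using (ℕ; zero; suc; _+_; _*_; _<_; _/_; _%_)
open import Data.Nat.Divisibility using (_∣_)
open import Data.Nat.Primality using (Prime)

open import Data.Product using (Σ; ∃; _×_; _,_)
open import Data.List using (List; length)
open import Data.List.Membership.Propositional using (_∈_)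
open import Data.List.Relation.Unary.Unique.Propositional using (Unique)
open import Relation.Binary.PropositionalEquality using (_≡_)
open import Relation.Nullary using (¬_)
open import Function.Bundles using (_⇔_)

V : ℕ → ℕ → Set
V n a = (0 < a) × (a ∣ n)

data Ω : ℕ → ℕ → Set where
  Ω-one   : Ω 1 0
  Ω-prime : ∀ {p m k} → Prime p → Ω m k → Ω (p * m) (suc k)

ΩOdd : ℕ → Set
ΩOdd a = ∃ λ k → Ω a k × k % 2 ≡ 1

EH : ℕ → ℕ × ℕ → Set
EH n (a , b) =
  V n a × V n b × a < b × a ∣ b ×
  (¬ (∃ λ c → V n c × a < c × c < b × a ∣ c × c ∣ b))

EO : ℕ → ℕ × ℕ → Set
EO n (a , b) = EH n (a , b) × ΩOdd a

HasCard : {A : Set} → (A → Set) → ℕ → Set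
HasCard {A} P k =
  Σ (List A) λ L → Unique L × (∀ x → (x ∈ L) ⇔ P x) × length L ≡ k

module Submission where

open import Defs
open import Data.Bool using (Bool; true; false; not)
open import Data.Nat using (ℕ; zero; suc; _+_; _*_; _^_; _%_; _/_; _≤_; _<_; z≤n; s≤s; z<s; s<s)
open import Data.Nat.Base using (nonTrivial⇒n>1; n>1⇒nonTrivial; >-nonZero; ≢-nonZero)
open import Data.Nat.Properties
  using (*-comm; *-assoc; *-identityˡ; *-zeroʳ; +-comm; +-identityʳ; *-cancelˡ-≡; *-monoʳ-<;
         m*n≡1⇒m≡1; m*n≡1⇒n≡1; m<m*n; m≤m*n; <-irrefl; ≤-refl; ≤-trans; ≤∧≢⇒<; n≢0⇒n>0; 0≢1+n; _≟_)
open import Data.Nat.DivMod using (+-distrib-/-∣ʳ; m<n⇒m/n≡0; m*n/n≡m)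
open import Data.Nat.Divisibility
  using (_∣_; divides; _∣?_; ∣-refl; ∣-trans; ∣1⇒≡1; ∣⇒≤; m∣m*n; n∣m*n; *-monoʳ-∣; *-cancelˡ-∣)
open import Data.Nat.Coprimality using (Coprime; coprime-divisor)
open import Data.Nat.Induction using (<-rec)
open import Data.Nat.ListAction using (product)
open import Data.Nat.Primality
  using (Prime; Irreducible; irreducible⇒prime; prime⇒nonZero; prime⇒nonTrivial; prime⇒irreducible; euclidsLemma)
open import Data.Nat.Primality.Factorisation using (factorise; PrimeFactorisation)
open import Data.Nat.Tactic.RingSolver using (solve-∀)
open import Data.Product using (Σ; ∃; _×_; _,_; proj₁; proj₂)
open import Data.Product.Properties using (×-≡,≡→≡)
open import Data.Product.Function.NonDependent.Propositional using (_×-⇔_)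
open import Data.Sum using (_⊎_; inj₁; inj₂)
open import Data.Sum.Function.Propositional using (_⊎-⇔_)
open import Data.Empty using (⊥; ⊥-elim)
open import Data.List using ([]; _∷_; [_]; _++_; map; length)
open import Data.List.Properties using (length-++; length-map)
open import Data.List.Membership.Propositional using (_∈_)
open import Data.List.Membership.Propositional.Properties using (++-∈⇔; ∈-map⁺; ∈-map⁻)
open import Data.List.Membership.Propositional.Properties.WithK using (unique∧set⇒bag)
open import Data.List.Relation.Binary.BagAndSetEquality using (∼bag⇒↭)
open import Data.List.Relation.Binary.Permutation.Propositional.Properties using (↭-length)
open import Data.List.Relation.Unary.All using (All; []; _∷_)
open import Data.List.Relation.Unary.AllPairs using ([]; _∷_)
open import Data.List.Relation.Unary.Any using (here)
open import Data.List.Relation.Unary.Unique.Propositional.Properties using (++⁺; map⁺)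
open import Function using (id)
open import Function.Bundles using (_⇔_; mk⇔; Equivalence)
import Function.Properties.Equivalence as ⇔
open import Relation.Binary.PropositionalEquality
  using (_≡_; _≢_; refl; sym; trans; cong; cong₂; subst; module ≡-Reasoning)
open import Relation.Nullary using (¬_; yes; no)

-- The arcs of the Hasse diagram of n are exactly the pairs (a , a * q) with q
-- prime and a * q ∣ n ("prime steps"); colour each by the parity of Ω of its
-- lower end a.  We prove by induction on n that the even arcs outnumber the
-- odd ones by 0 or 1, which is |E_O(n)| = ⌊|E^H(n)| / 2⌋.  Writing
-- n = p ^ k * m with p ∤ m: the divisors of p ^ (j + 1) * m are those of m
-- together with p times those of p ^ j * m, and its prime steps are those of
-- m, the steps (x , x * p) with x ∣ m, and p times the steps of p ^ j * m.
-- Multiplying by p flips parities, so along the tower m, p * m, p ^ 2 * m, …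
-- the excess (even minus odd) of the divisors alternates between δ and 0 and
-- that of the steps between α and δ, where δ, α ≤ 1 are the excesses for m.

private
  variable
    A B : Set
    k l p q x y : ℕ

card-unique : {P : A → Set} → HasCard P k → HasCard P l → k ≡ l
card-unique (L , uL , L⇔P , refl) (M , uM , M⇔P , refl) =
  ↭-length (∼bag⇒↭ (unique∧set⇒bag uL uM (λ {x} → ⇔.trans (L⇔P x) (⇔.sym (M⇔P x)))))

card-cong : {P Q : A → Set} → (∀ x → P x ⇔ Q x) → HasCard P k → HasCard Q k
card-cong P⇔Q (L , u , L⇔P , len) = L , u , (λ x → ⇔.trans (L⇔P x) (P⇔Q x)) , len

card-union : {P Q : A → Set} → (∀ x → P x → Q x → ⊥) →
  HasCard P k → HasCard Q l → HasCard (λ x → P x ⊎ Q x) (k + l)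
card-union disjoint (L , uL , L⇔P , refl) (M , uM , M⇔Q , refl) =
  L ++ M ,
  ++⁺ uL uM (λ (x∈L , x∈M) → disjoint _ (Equivalence.to (L⇔P _) x∈L) (Equivalence.to (M⇔Q _) x∈M)) ,
  (λ x → ⇔.trans ++-∈⇔ (L⇔P x ⊎-⇔ M⇔Q x)) ,
  length-++ L

Image : (A → B) → (A → Set) → B → Set
Image f P y = ∃ λ x → P x × f x ≡ y

card-image : {P : A → Set} (f : A → B) → (∀ {x y} → f x ≡ f y → x ≡ y) →
  HasCard P k → HasCard (Image f P) k
card-image {P = P} f f-injective (L , u , L⇔P , refl) =
  map f L , map⁺ f-injective u , (λ y → mk⇔ to from) , length-map f L
  where
  to : ∀ {y} → y ∈ map f L → Image f P y
  to y∈ with ∈-map⁻ f y∈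
  ... | x , x∈L , refl = x , Equivalence.to (L⇔P x) x∈L , refl
  from : ∀ {y} → Image f P y → y ∈ map f L
  from (x , Px , refl) = ∈-map⁺ f (Equivalence.from (L⇔P x) Px)

card-empty : {P : A → Set} → (∀ a → ¬ P a) → HasCard P 0
card-empty empty = [] , [] , (λ a → mk⇔ (λ ()) (λ Pa → ⊥-elim (empty a Pa))) , refl

card-singleton : {P : A → Set} {a : A} → P a → (∀ a′ → P a′ → a′ ≡ a) → HasCard P 1
card-singleton {a = a} Pa unique =
  [ a ] , [] ∷ [] , (λ a′ → mk⇔ (λ { (here refl) → Pa }) (λ Pa′ → here (unique a′ Pa′))) , refl

*-positive : 0 < x → 0 < y → 0 < x * y
*-positive {suc x} {suc y} _ _ = z<s

prime>1 : Prime p → 1 < p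
prime>1 {p} p-prime = nonTrivial⇒n>1 p {{prime⇒nonTrivial p-prime}}

prime-positive : Prime p → 0 < p
prime-positive p-prime with prime>1 p-prime
... | s<s _ = z<s

≢0∧≢1⇒>1 : x ≢ 0 → x ≢ 1 → 1 < x
≢0∧≢1⇒>1 {0} x≢0 _ = ⊥-elim (x≢0 refl)
≢0∧≢1⇒>1 {1} _ x≢1 = ⊥-elim (x≢1 refl)
≢0∧≢1⇒>1 {suc (suc x)} _ _ = s<s z<s

prime-cancel : Prime p → p * x ≡ p * y → x ≡ y
prime-cancel {p} {x} {y} p-prime = *-cancelˡ-≡ x y p {{prime⇒nonZero p-prime}}

prime∣prime : Prime p → Prime q → p ∣ q → p ≡ q
prime∣prime p-prime q-prime p∣q with prime⇒irreducible q-prime p∣q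
... | inj₁ refl = ⊥-elim (<-irrefl refl (prime>1 p-prime))
... | inj₂ p≡q = p≡q

prime*≢1 : Prime p → p * x ≢ 1
prime*≢1 {p} {x} p-prime p*x≡1 = <-irrefl (sym (m*n≡1⇒m≡1 p x p*x≡1)) (prime>1 p-prime)

Ω-peel : Prime p → Ω x k → x ≡ p * y → ∃ λ k′ → k ≡ suc k′ × Ω y k′
Ω-peel p-prime Ω-one 1≡p*y = ⊥-elim (prime*≢1 p-prime (sym 1≡p*y))
Ω-peel {p} {y = y} p-prime (Ω-prime {q} {m} {k} q-prime ω) q*m≡p*y with q ≟ p
... | yes refl = k , refl , subst (λ z → Ω z k) (prime-cancel q-prime q*m≡p*y) ω
... | no q≢p with euclidsLemma q m p-prime (divides y (trans q*m≡p*y (*-comm p y)))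
...   | inj₁ p∣q = ⊥-elim (q≢p (sym (prime∣prime p-prime q-prime p∣q)))
...   | inj₂ (divides m′ m≡m′*p) with Ω-peel p-prime ω (trans m≡m′*p (*-comm m′ p))
...     | k′ , refl , ω′ = suc k′ , refl , subst (λ z → Ω z (suc k′)) q*m′≡y (Ω-prime q-prime ω′)
  where
  q*m′≡y : q * m′ ≡ y
  q*m′≡y = prime-cancel p-prime (begin
    p * (q * m′)   ≡⟨ sym (*-assoc p q m′) ⟩
    p * q * m′     ≡⟨ cong (_* m′) (*-comm p q) ⟩
    q * p * m′     ≡⟨ *-assoc q p m′ ⟩
    q * (p * m′)   ≡⟨ cong (q *_) (*-comm p m′) ⟩
    q * (m′ * p)   ≡⟨ cong (q *_) (sym m≡m′*p) ⟩
    q * m          ≡⟨ q*m≡p*y ⟩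
    p * y          ∎)
    where open ≡-Reasoning

Ω-functional : Ω x k → Ω x l → k ≡ l
Ω-functional Ω-one ω′ = sym (Ω-one-only ω′ refl)
  where
  Ω-one-only : Ω x l → x ≡ 1 → l ≡ 0
  Ω-one-only Ω-one _ = refl
  Ω-one-only (Ω-prime p-prime _) p*m≡1 = ⊥-elim (prime*≢1 p-prime p*m≡1)
Ω-functional (Ω-prime p-prime ω) ω′ with Ω-peel p-prime ω′ refl
... | _ , refl , ω″ = cong suc (Ω-functional ω ω″)

Ω-product : ∀ {ps} → All Prime ps → Ω (product ps) (length ps)
Ω-product [] = Ω-one
Ω-product (p-prime ∷ ps-prime) = Ω-prime p-prime (Ω-product ps-prime)

Ω-total : 0 < x → ∃ λ k → Ω x k
Ω-total {suc x} _ =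
  length factors , subst (λ z → Ω z (length factors)) (sym isFactorisation) (Ω-product factorsPrime)
  where open PrimeFactorisation (factorise (suc x))

Ω-positive : Ω x k → 0 < x
Ω-positive Ω-one = z<s
Ω-positive (Ω-prime p-prime ω) = *-positive (prime-positive p-prime) (Ω-positive ω)

residue : Bool → ℕ
residue false = 0
residue true = 1

residue-total : ∀ k → ∃ λ b → k % 2 ≡ residue b
residue-total 0 = false , refl
residue-total 1 = true , refl
residue-total (suc (suc k)) = residue-total k

suc-flips-residue : ∀ b k → (suc k % 2 ≡ residue b) ⇔ (k % 2 ≡ residue (not b))
suc-flips-residue false 0 = mk⇔ (λ ()) (λ ())
suc-flips-residue true 0 = mk⇔ (λ _ → refl) (λ _ → refl)
suc-flips-residue false 1 = mk⇔ (λ _ → refl) (λ _ → refl)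
suc-flips-residue true 1 = mk⇔ (λ ()) (λ ())
suc-flips-residue b (suc (suc k)) = suc-flips-residue b k

Parity : Bool → ℕ → Set
Parity b x = ∃ λ k → Ω x k × k % 2 ≡ residue b

parity-positive : ∀ {b} → Parity b x → 0 < x
parity-positive (_ , ω , _) = Ω-positive ω

parity-total : 0 < x → ∃ λ b → Parity b x
parity-total x>0 with Ω-total x>0
... | k , ω with residue-total k
...   | b , k≡b = b , k , ω , k≡b

parity-exclusive : Parity false x → Parity true x → ⊥
parity-exclusive (k , ω , k-even) (l , ω′ , l-odd) with Ω-functional ω ω′
... | refl with trans (sym k-even) l-odd
...   | ()

parity-flip : ∀ b → Prime p → Parity b (p * x) ⇔ Parity (not b) x
parity-flip {p} {x} b p-prime = mk⇔ down up
  where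
  down : Parity b (p * x) → Parity (not b) x
  down (k , ω , r) with Ω-peel p-prime ω refl
  ... | k′ , refl , ω′ = k′ , ω′ , Equivalence.to (suc-flips-residue b k′) r
  up : Parity (not b) x → Parity b (p * x)
  up (k , ω , r) = suc k , Ω-prime p-prime ω , Equivalence.from (suc-flips-residue b k) r

PrimeStep : ℕ → ℕ × ℕ → Set
PrimeStep N (x , y) = ∃ λ q → Prime q × y ≡ x * q × y ∣ N

-- An arc of the Hasse diagram multiplies its lower end by a prime: the
-- quotient t = b / a is irreducible, since a proper divisor d of t would
-- give the divisor a · d of N strictly between a and b.
hasse⇒prime-step : ∀ {N a b} → EH N (a , b) → PrimeStep N (a , b)
hasse⇒prime-step {N} {a} {b} ((a>0 , _) , (b>0 , b∣N) , a<b , divides t b≡t*a , no-middle) =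
  t , t-prime , trans b≡t*a (*-comm t a) , b∣N
  where
  t≢0 : t ≢ 0
  t≢0 refl = <-irrefl (sym b≡t*a) b>0
  t≢1 : t ≢ 1
  t≢1 refl = <-irrefl (trans (sym (*-identityˡ a)) (sym b≡t*a)) a<b
  t-irreducible : Irreducible t
  t-irreducible {d} (divides s t≡s*d) with d ≟ 1 | d ≟ t
  ... | yes d≡1 | _ = inj₁ d≡1
  ... | no _ | yes d≡t = inj₂ d≡t
  ... | no d≢1 | no d≢t =
    ⊥-elim (no-middle (a * d , (a*d>0 , ∣-trans a*d∣b b∣N) , a<a*d , a*d<b , m∣m*n d , a*d∣b))
    where
    d≢0 : d ≢ 0
    d≢0 refl = t≢0 (trans t≡s*d (*-zeroʳ s))
    a*d>0 : 0 < a * d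
    a*d>0 = *-positive a>0 (n≢0⇒n>0 d≢0)
    a<a*d : a < a * d
    a<a*d = m<m*n a d {{>-nonZero a>0}} (≢0∧≢1⇒>1 d≢0 d≢1)
    a*d<b : a * d < b
    a*d<b = subst (a * d <_) (trans (*-comm a t) (sym b≡t*a))
      (*-monoʳ-< a {{>-nonZero a>0}} (≤∧≢⇒< (∣⇒≤ {{≢-nonZero t≢0}} (divides s t≡s*d)) d≢t))
    a*d∣b : a * d ∣ b
    a*d∣b = divides s (begin
      b            ≡⟨ b≡t*a ⟩
      t * a        ≡⟨ cong (_* a) t≡s*d ⟩
      s * d * a    ≡⟨ *-assoc s d a ⟩
      s * (d * a)  ≡⟨ cong (s *_) (*-comm d a) ⟩
      s * (a * d)  ∎)
      where open ≡-Reasoning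
  t-prime : Prime t
  t-prime = irreducible⇒prime {{n>1⇒nonTrivial (≢0∧≢1⇒>1 t≢0 t≢1)}} t-irreducible

-- Conversely a prime step is a Hasse arc: between a and a · q only a and
-- a · q themselves are multiples of a dividing a · q.
prime-step⇒hasse : ∀ {N a b} → 0 < a → PrimeStep N (a , b) → EH N (a , b)
prime-step⇒hasse {N} {a} {b} a>0 (q , q-prime , b≡a*q , b∣N) =
  (a>0 , ∣-trans a∣b b∣N) , (b>0 , b∣N) , a<b , a∣b , no-middle
  where
  b>0 : 0 < b
  b>0 = subst (0 <_) (sym b≡a*q) (*-positive a>0 (prime-positive q-prime))
  a∣b : a ∣ b
  a∣b = divides q (trans b≡a*q (*-comm a q))
  a<b : a < b
  a<b = subst (a <_) (sym b≡a*q) (m<m*n a q {{>-nonZero a>0}} (prime>1 q-prime))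
  no-middle : ¬ (∃ λ c → V N c × a < c × c < b × a ∣ c × c ∣ b)
  no-middle (c , _ , a<c , c<b , divides s c≡s*a , divides r b≡r*c)
    with prime⇒irreducible q-prime (divides r q≡r*s)
    where
    q≡r*s : q ≡ r * s
    q≡r*s = *-cancelˡ-≡ q (r * s) a {{>-nonZero a>0}} (begin
      a * q          ≡⟨ sym b≡a*q ⟩
      b              ≡⟨ b≡r*c ⟩
      r * c          ≡⟨ cong (r *_) c≡s*a ⟩
      r * (s * a)    ≡⟨ sym (*-assoc r s a) ⟩
      r * s * a      ≡⟨ *-comm (r * s) a ⟩
      a * (r * s)    ∎)
      where open ≡-Reasoning
  ... | inj₁ refl = <-irrefl (sym (trans c≡s*a (*-identityˡ a))) a<c
  ... | inj₂ refl = <-irrefl (trans c≡s*a (trans (*-comm s a) (sym b≡a*q))) c<b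

-- Graded g P c: for each parity b, exactly c b elements a of P have g a of
-- parity b.  Divisors are graded by themselves, prime steps by their lower end.
Graded : {A : Set} → (A → ℕ) → (A → Set) → (Bool → ℕ) → Set
Graded g P c = ∀ b → HasCard (λ a → P a × Parity b (g a)) (c b)

graded-cong : {g : A → ℕ} {P Q : A → Set} {c : Bool → ℕ} →
  (∀ a → P a ⇔ Q a) → Graded g P c → Graded g Q c
graded-cong P⇔Q graded b = card-cong (λ a → P⇔Q a ×-⇔ ⇔.refl) (graded b)

graded-union : {g : A → ℕ} {P Q : A → Set} {c d : Bool → ℕ} → (∀ a → P a → Q a → ⊥) →
  Graded g P c → Graded g Q d → Graded g (λ a → P a ⊎ Q a) (λ b → c b + d b)
graded-union {P = P} {Q} disjoint graded-P graded-Q b =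
  card-cong (λ a → mk⇔ factor-parity expand-parity)
    (card-union (λ a (Pa , _) (Qa , _) → disjoint a Pa Qa) (graded-P b) (graded-Q b))
  where
  factor-parity : ∀ {a R} → (P a × R) ⊎ (Q a × R) → (P a ⊎ Q a) × R
  factor-parity (inj₁ (Pa , r)) = inj₁ Pa , r
  factor-parity (inj₂ (Qa , r)) = inj₂ Qa , r
  expand-parity : ∀ {a R} → (P a ⊎ Q a) × R → (P a × R) ⊎ (Q a × R)
  expand-parity (inj₁ Pa , r) = inj₁ (Pa , r)
  expand-parity (inj₂ Qa , r) = inj₂ (Qa , r)

graded-image : {g : A → ℕ} {h : B → ℕ} {P : A → Set} {c : Bool → ℕ}
  (f : A → B) → (∀ {a a′} → f a ≡ f a′ → a ≡ a′) → (σ : Bool → Bool) →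
  (∀ b a → Parity b (h (f a)) ⇔ Parity (σ b) (g a)) →
  Graded g P c → Graded h (Image f P) (λ b → c (σ b))
graded-image {g = g} {h} {P} f f-injective σ shift graded b =
  card-cong (λ _ → mk⇔ to from) (card-image f f-injective (graded (σ b)))
  where
  to : ∀ {y} → Image f (λ a → P a × Parity (σ b) (g a)) y → Image f P y × Parity b (h y)
  to (a , (Pa , parity) , refl) = (a , Pa , refl) , Equivalence.from (shift b a) parity
  from : ∀ {y} → Image f P y × Parity b (h y) → Image f (λ a → P a × Parity (σ b) (g a)) y
  from ((a , Pa , refl) , parity) = a , (Pa , Equivalence.to (shift b a) parity) , refl

module PrimePowerLayers {p m : ℕ} (p-prime : Prime p) (p∤m : ¬ p ∣ m) where

  p∤divisor : x ∣ m → ¬ p ∣ x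
  p∤divisor x∣m p∣x = p∤m (∣-trans p∣x x∣m)

  coprime-part : ∀ j → ¬ p ∣ x → x ∣ p ^ j * m → x ∣ m
  coprime-part {x} zero _ x∣m = subst (x ∣_) (*-identityˡ m) x∣m
  coprime-part {x} (suc j) p∤x x∣ =
    coprime-part j p∤x (coprime-divisor x⊥p (subst (x ∣_) (*-assoc p (p ^ j) m) x∣))
    where
    x⊥p : Coprime x p
    x⊥p (i∣x , i∣p) with prime⇒irreducible p-prime i∣p
    ... | inj₁ i≡1 = i≡1
    ... | inj₂ refl = ⊥-elim (p∤x i∣x)

  m∣layer : ∀ j → m ∣ p ^ j * m
  m∣layer j = n∣m*n (p ^ j)

  p*-∣-layer : ∀ j → x ∣ p ^ j * m → p * x ∣ p ^ suc j * m
  p*-∣-layer {x} j x∣ = subst (p * x ∣_) (sym (*-assoc p (p ^ j) m)) (*-monoʳ-∣ p x∣)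

  p*-∣-layer⁻¹ : ∀ j → p * x ∣ p ^ suc j * m → x ∣ p ^ j * m
  p*-∣-layer⁻¹ {x} j p*x∣ =
    *-cancelˡ-∣ p {{prime⇒nonZero p-prime}} (subst (p * x ∣_) (*-assoc p (p ^ j) m) p*x∣)

  divisor-split : ∀ j x → (x ∣ m ⊎ Image (p *_) (_∣ p ^ j * m) x) ⇔ x ∣ p ^ suc j * m
  divisor-split j x = mk⇔ merge split
    where
    merge : x ∣ m ⊎ Image (p *_) (_∣ p ^ j * m) x → x ∣ p ^ suc j * m
    merge (inj₁ x∣m) = ∣-trans x∣m (m∣layer (suc j))
    merge (inj₂ (x′ , x′∣ , refl)) = p*-∣-layer j x′∣
    split : x ∣ p ^ suc j * m → x ∣ m ⊎ Image (p *_) (_∣ p ^ j * m) x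
    split x∣ with p ∣? x
    ... | no p∤x = inj₁ (coprime-part (suc j) p∤x x∣)
    ... | yes (divides x′ refl) =
      inj₂ (x′ , p*-∣-layer⁻¹ j (subst (_∣ p ^ suc j * m) (*-comm x′ p) x∣) , *-comm p x′)

  divisor-disjoint : ∀ j x → x ∣ m → Image (p *_) (_∣ p ^ j * m) x → ⊥
  divisor-disjoint j _ x∣m (x′ , _ , refl) = p∤divisor x∣m (m∣m*n x′)

  up : ℕ → ℕ × ℕ
  up x = x , x * p

  scale : ℕ × ℕ → ℕ × ℕ
  scale xy = p * proj₁ xy , p * proj₂ xy

  step-split : ∀ j xy →
    ((PrimeStep m xy ⊎ Image up (_∣ m) xy) ⊎ Image scale (PrimeStep (p ^ j * m)) xy) ⇔
    PrimeStep (p ^ suc j * m) xy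
  step-split j (x , y) = mk⇔ merge split
    where
    merge : (PrimeStep m (x , y) ⊎ Image up (_∣ m) (x , y)) ⊎
            Image scale (PrimeStep (p ^ j * m)) (x , y) → PrimeStep (p ^ suc j * m) (x , y)
    merge (inj₁ (inj₁ (q , q-prime , y≡x*q , y∣m))) =
      q , q-prime , y≡x*q , ∣-trans y∣m (m∣layer (suc j))
    merge (inj₁ (inj₂ (x , x∣m , refl))) =
      p , p-prime , refl ,
      subst (_∣ p ^ suc j * m) (*-comm p x) (p*-∣-layer j (∣-trans x∣m (m∣layer j)))
    merge (inj₂ ((x′ , y′) , (q , q-prime , refl , y′∣) , refl)) =
      q , q-prime , sym (*-assoc p x′ q) , p*-∣-layer j y′∣
    split : PrimeStep (p ^ suc j * m) (x , y) →
            (PrimeStep m (x , y) ⊎ Image up (_∣ m) (x , y)) ⊎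
            Image scale (PrimeStep (p ^ j * m)) (x , y)
    -- If p ∣ x the step is p times a step below p ^ j * m; otherwise it is
    -- the step up by p from a divisor of m, or lies entirely below m.
    split (q , q-prime , y≡x*q , y∣) with p ∣? x
    ... | yes (divides x′ refl) =
      inj₂ ((x′ , x′ * q) , (q , q-prime , refl , p*-∣-layer⁻¹ j p*x′*q∣) ,
            cong₂ _,_ (*-comm p x′) (sym y≡p*x′*q))
      where
      y≡p*x′*q : y ≡ p * (x′ * q)
      y≡p*x′*q = trans y≡x*q (trans (cong (_* q) (*-comm x′ p)) (*-assoc p x′ q))
      p*x′*q∣ : p * (x′ * q) ∣ p ^ suc j * m
      p*x′*q∣ = subst (_∣ p ^ suc j * m) y≡p*x′*q y∣
    ... | no p∤x with q ≟ p
    ...   | yes refl =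
      inj₁ (inj₂ (x , coprime-part (suc j) p∤x (∣-trans (divides q (trans y≡x*q (*-comm x q))) y∣) ,
                  cong (x ,_) (sym y≡x*q)))
    ...   | no q≢p = inj₁ (inj₁ (q , q-prime , y≡x*q , coprime-part (suc j) p∤y y∣))
      where
      p∤y : ¬ p ∣ y
      p∤y p∣y with euclidsLemma x q p-prime (subst (p ∣_) y≡x*q p∣y)
      ... | inj₁ p∣x = p∤x p∣x
      ... | inj₂ p∣q = q≢p (sym (prime∣prime p-prime q-prime p∣q))

  -- The three kinds of steps are distinct: in the first two the lower end
  -- divides m, in the last it is a multiple of p.
  step-disjoint-up : ∀ xy → PrimeStep m xy → Image up (_∣ m) xy → ⊥
  step-disjoint-up _ (_ , _ , _ , y∣m) (x , _ , refl) = p∤divisor y∣m (n∣m*n x)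

  step-disjoint-scale : ∀ j xy → PrimeStep m xy ⊎ Image up (_∣ m) xy →
    Image scale (PrimeStep (p ^ j * m)) xy → ⊥
  step-disjoint-scale j _ lower ((x′ , _) , _ , refl) = p∤divisor (lower-divides lower) (m∣m*n x′)
    where
    lower-divides : ∀ {xy} → PrimeStep m xy ⊎ Image up (_∣ m) xy → proj₁ xy ∣ m
    lower-divides (inj₁ (q , _ , y≡x*q , y∣m)) = ∣-trans (divides q (trans y≡x*q (*-comm _ q))) y∣m
    lower-divides (inj₂ (_ , x∣m , refl)) = x∣m

  -- Hence the parity counts of the divisors of p ^ (j + 1) * m: divisors of m
  -- keep their parity, p times a divisor of p ^ j * m flips it.
  divisor-counts : ∀ j {D E : Bool → ℕ} → Graded id (_∣ m) D → Graded id (_∣ p ^ j * m) E →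
    Graded id (_∣ p ^ suc j * m) (λ b → D b + E (not b))
  divisor-counts j graded-D graded-E =
    graded-cong (divisor-split j)
      (graded-union (divisor-disjoint j) graded-D
        (graded-image (p *_) (prime-cancel p-prime) not (λ b _ → parity-flip b p-prime) graded-E))

  -- Likewise for the prime steps; a step up by p keeps the parity of its lower end.
  step-counts : ∀ j {A D E : Bool → ℕ} → Graded proj₁ (PrimeStep m) A → Graded id (_∣ m) D →
    Graded proj₁ (PrimeStep (p ^ j * m)) E →
    Graded proj₁ (PrimeStep (p ^ suc j * m)) (λ b → (A b + D b) + E (not b))
  step-counts j graded-A graded-D graded-E =
    graded-cong (step-split j)
      (graded-union (step-disjoint-scale j)
        (graded-union step-disjoint-up graded-A
          (graded-image up (cong proj₁) (λ b → b) (λ _ _ → ⇔.refl) graded-D))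
        (graded-image scale scale-injective not (λ b _ → parity-flip b p-prime) graded-E))
    where
    scale-injective : ∀ {xy xy′} → scale xy ≡ scale xy′ → xy ≡ xy′
    scale-injective eq =
      ×-≡,≡→≡ (prime-cancel p-prime (cong proj₁ eq) , prime-cancel p-prime (cong proj₂ eq))

Excess : (Bool → ℕ) → ℕ → Set
Excess c ε = c false ≡ c true + ε

excess-sum : ∀ {c d ε δ} → Excess c ε → Excess d δ → Excess (λ b → c b + d b) (ε + δ)
excess-sum {c} {d} {ε} {δ} excess-c excess-d = begin
  c false + d false               ≡⟨ cong₂ _+_ excess-c excess-d ⟩
  (c true + ε) + (d true + δ)     ≡⟨ rearrange (c true) ε (d true) δ ⟩
  (c true + d true) + (ε + δ)     ∎
  where
  open ≡-Reasoning
  rearrange : ∀ a ε b δ → (a + ε) + (b + δ) ≡ (a + b) + (ε + δ)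
  rearrange = solve-∀

excess-flip : ∀ {c d ε δ w} → Excess c ε → Excess d δ → ε ≡ δ + w →
  Excess (λ b → c b + d (not b)) w
excess-flip {c} {d} {ε} {δ} {w} excess-c excess-d ε≡δ+w = begin
  c false + d true                ≡⟨ cong (_+ d true) (trans excess-c (cong (c true +_) ε≡δ+w)) ⟩
  (c true + (δ + w)) + d true     ≡⟨ rearrange (c true) (d true) δ w ⟩
  (c true + (d true + δ)) + w     ≡⟨ cong (λ z → (c true + z) + w) (sym excess-d) ⟩
  (c true + d false) + w          ∎
  where
  open ≡-Reasoning
  rearrange : ∀ a b δ w → (a + (δ + w)) + b ≡ (a + (b + δ)) + w
  rearrange = solve-∀

NearlyEven : {A : Set} → (A → ℕ) → (A → Set) → Set
NearlyEven g P = Σ (Bool → ℕ) λ c → Graded g P c × Σ ℕ λ ε → ε ≤ 1 × Excess c ε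

-- The invariant established by induction on n: both the divisors and the
-- prime steps (equivalently, the Hasse arcs) of n are nearly even.
Balanced : ℕ → Set
Balanced N = NearlyEven id (_∣ N) × NearlyEven proj₁ (PrimeStep N)

module Tower {p m : ℕ} (p-prime : Prime p) (p∤m : ¬ p ∣ m) where
  open PrimePowerLayers p-prime p∤m

  layer₀ : m ≡ p ^ 0 * m
  layer₀ = sym (*-identityˡ m)

  divisor-tower : ∀ {D δ} → Graded id (_∣ m) D → Excess D δ → ∀ j →
    Σ (Bool → ℕ) λ E → Graded id (_∣ p ^ j * m) E × (Excess E δ ⊎ Excess E 0)
  divisor-tower {D} graded-D excess-D zero =
    D , subst (λ N → Graded id (_∣ N) D) layer₀ graded-D , inj₁ excess-D
  divisor-tower {D} {δ} graded-D excess-D (suc j) with divisor-tower graded-D excess-D j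
  ... | E , graded-E , excess-E = _ , divisor-counts j graded-D graded-E , next excess-E
    where
    next : Excess E δ ⊎ Excess E 0 →
      Excess (λ b → D b + E (not b)) δ ⊎ Excess (λ b → D b + E (not b)) 0
    next (inj₁ excess-δ) = inj₂ (excess-flip {c = D} {d = E} excess-D excess-δ (sym (+-identityʳ δ)))
    next (inj₂ excess-0) = inj₁ (excess-flip {c = D} {d = E} excess-D excess-0 refl)

  step-tower : ∀ {A D α δ} → Graded proj₁ (PrimeStep m) A → Excess A α →
    Graded id (_∣ m) D → Excess D δ → ∀ j →
    Σ (Bool → ℕ) λ E → Graded proj₁ (PrimeStep (p ^ j * m)) E × (Excess E α ⊎ Excess E δ)
  step-tower {A} graded-A excess-A _ _ zero =
    A , subst (λ N → Graded proj₁ (PrimeStep N) A) layer₀ graded-A , inj₁ excess-A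
  step-tower {A} {D} {α} {δ} graded-A excess-A graded-D excess-D (suc j)
    with step-tower graded-A excess-A graded-D excess-D j
  ... | E , graded-E , excess-E = _ , step-counts j graded-A graded-D graded-E , next excess-E
    where
    C : Bool → ℕ
    C b = (A b + D b) + E (not b)
    excess-A+D : Excess (λ b → A b + D b) (α + δ)
    excess-A+D = excess-sum {c = A} {d = D} excess-A excess-D
    next : Excess E α ⊎ Excess E δ → Excess C α ⊎ Excess C δ
    next (inj₁ excess-α) =
      inj₂ (excess-flip {c = λ b → A b + D b} {d = E} excess-A+D excess-α refl)
    next (inj₂ excess-δ) =
      inj₁ (excess-flip {c = λ b → A b + D b} {d = E} excess-A+D excess-δ (+-comm α δ))

  balanced-tower : Balanced m → ∀ j → Balanced (p ^ j * m)
  balanced-tower ((D , graded-D , δ , δ≤1 , excess-D) , (A , graded-A , α , α≤1 , excess-A)) j =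
    divisors , steps
    where
    divisors : NearlyEven id (_∣ p ^ j * m)
    divisors with divisor-tower graded-D excess-D j
    ... | E , graded-E , inj₁ excess-E = E , graded-E , δ , δ≤1 , excess-E
    ... | E , graded-E , inj₂ excess-E = E , graded-E , 0 , z≤n , excess-E
    steps : NearlyEven proj₁ (PrimeStep (p ^ j * m))
    steps with step-tower graded-A excess-A graded-D excess-D j
    ... | E , graded-E , inj₁ excess-E = E , graded-E , α , α≤1 , excess-E
    ... | E , graded-E , inj₂ excess-E = E , graded-E , δ , δ≤1 , excess-E

-- The only divisor of 1 is 1, which is even, and there are no prime steps.
balanced-one : Balanced 1
balanced-one =
  (divisor-count , graded-divisors , 1 , ≤-refl , refl) , ((λ _ → 0) , graded-steps , 0 , z≤n , refl)
  where
  divisor-count : Bool → ℕ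
  divisor-count false = 1
  divisor-count true = 0
  one-even : Parity false 1
  one-even = 0 , Ω-one , refl
  graded-divisors : Graded id (_∣ 1) divisor-count
  graded-divisors false = card-singleton (∣-refl , one-even) (λ x (x∣1 , _) → ∣1⇒≡1 x∣1)
  graded-divisors true = card-empty λ x (x∣1 , x-odd) →
    parity-exclusive one-even (subst (Parity true) (∣1⇒≡1 x∣1) x-odd)
  graded-steps : Graded proj₁ (PrimeStep 1) (λ _ → 0)
  graded-steps b = card-empty λ { (x , y) ((q , q-prime , y≡x*q , y∣1) , _) →
    <-irrefl (sym (m*n≡1⇒n≡1 x q (trans (sym y≡x*q) (∣1⇒≡1 y∣1)))) (prime>1 q-prime) }

prime-factor : 1 < x → ∃ λ p → Prime p × p ∣ x
prime-factor {suc x} 1<x with factorise (suc x)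
... | record { factors = [] ; isFactorisation = x≡1 } = ⊥-elim (<-irrefl (sym x≡1) 1<x)
... | record { factors = p ∷ ps ; isFactorisation = x≡p*ps ; factorsPrime = p-prime ∷ _ } =
  p , p-prime , divides (product ps) (trans x≡p*ps (*-comm p (product ps)))

PrimePowerSplit : ℕ → ℕ → Set
PrimePowerSplit p n = ∃ λ k → ∃ λ m → ¬ p ∣ m × m ≤ n × n ≡ p ^ k * m

prime-power-split : Prime p → ∀ n → 0 < n → PrimePowerSplit p n
prime-power-split {p} p-prime = <-rec _ divide-out
  where
  divide-out : ∀ n → (∀ {n′} → n′ < n → 0 < n′ → PrimePowerSplit p n′) → 0 < n → PrimePowerSplit p n
  divide-out n _ _ with p ∣? n
  divide-out n _ _ | no p∤n = 0 , n , p∤n , ≤-refl , sym (*-identityˡ n)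
  divide-out _ recurse n>0 | yes (divides n′ refl) with recurse n′<n n′>0
    where
    n′>0 : 0 < n′
    n′>0 = n≢0⇒n>0 λ { refl → <-irrefl refl n>0 }
    n′<n : n′ < n′ * p
    n′<n = m<m*n n′ p {{>-nonZero n′>0}} (prime>1 p-prime)
  ... | k , m , p∤m , m≤n′ , n′≡p^k*m =
    suc k , m , p∤m , ≤-trans m≤n′ (m≤m*n n′ p {{prime⇒nonZero p-prime}}) , (begin
      n′ * p           ≡⟨ *-comm n′ p ⟩
      p * n′           ≡⟨ cong (p *_) n′≡p^k*m ⟩
      p * (p ^ k * m)  ≡⟨ sym (*-assoc p (p ^ k) m) ⟩
      p ^ suc k * m    ∎)
    where open ≡-Reasoning

-- Main induction: split off a prime p ∣ n as n = p ^ k * m with p ∤ m; then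
-- m < n is balanced and the tower over m reaches n.
balanced : ∀ n → 0 < n → Balanced n
balanced = <-rec _ split-off-prime
  where
  split-off-prime : ∀ n → (∀ {m} → m < n → 0 < m → Balanced m) → 0 < n → Balanced n
  split-off-prime 1 _ _ = balanced-one
  split-off-prime n@(suc (suc _)) balanced-below _ with prime-factor {n} (s<s z<s)
  ... | p , p-prime , p∣n with prime-power-split p-prime n z<s
  ...   | k , m , p∤m , m≤n , n≡p^k*m =
    subst Balanced (sym n≡p^k*m) (Tower.balanced-tower p-prime p∤m (balanced-below m<n m>0) k)
    where
    m>0 : 0 < m
    m>0 = n≢0⇒n>0 λ { refl → 0≢1+n (sym (trans n≡p^k*m (*-zeroʳ (p ^ k)))) }
    m<n : m < n
    m<n = ≤∧≢⇒< m≤n λ { refl → p∤m p∣n }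

hasse⇔prime-step : ∀ {n} b ab →
  (PrimeStep n ab × Parity b (proj₁ ab)) ⇔ (EH n ab × Parity b (proj₁ ab))
hasse⇔prime-step b (x , y) = mk⇔
  (λ (step , parity) → prime-step⇒hasse (parity-positive parity) step , parity)
  (λ (arc , parity) → hasse⇒prime-step arc , parity)

hasse-count : ∀ {n c} → Graded proj₁ (PrimeStep n) c → HasCard (EH n) (c false + c true)
hasse-count {n} graded =
  card-cong (λ ab → mk⇔ forget-parity (recover-parity ab))
    (card-union (λ _ (_ , even) (_ , odd) → parity-exclusive even odd)
      (card-cong (hasse⇔prime-step false) (graded false))
      (card-cong (hasse⇔prime-step true) (graded true)))
  where
  ArcOfParity : Bool → ℕ × ℕ → Set
  ArcOfParity b ab = EH n ab × Parity b (proj₁ ab)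
  forget-parity : ∀ {ab} → ArcOfParity false ab ⊎ ArcOfParity true ab → EH n ab
  forget-parity (inj₁ (arc , _)) = arc
  forget-parity (inj₂ (arc , _)) = arc
  recover-parity : ∀ ab → EH n ab → ArcOfParity false ab ⊎ ArcOfParity true ab
  recover-parity (a , _) arc@((a>0 , _) , _) with parity-total a>0
  ... | false , even = inj₁ (arc , even)
  ... | true , odd = inj₂ (arc , odd)

odd-hasse-count : ∀ {n c} → Graded proj₁ (PrimeStep n) c → HasCard (EO n) (c true)
odd-hasse-count graded = card-cong (hasse⇔prime-step true) (graded true)

half-of-near-double : ∀ o α → α ≤ 1 → (o + α + o) / 2 ≡ o
half-of-near-double o α α≤1 = begin
  (o + α + o) / 2      ≡⟨ cong (_/ 2) (rearrange o α) ⟩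
  (α + o * 2) / 2      ≡⟨ +-distrib-/-∣ʳ α (n∣m*n o) ⟩
  α / 2 + o * 2 / 2    ≡⟨ cong₂ _+_ (m<n⇒m/n≡0 (s≤s α≤1)) (m*n/n≡m o 2) ⟩
  o                    ∎
  where
  open ≡-Reasoning
  rearrange : ∀ o α → o + α + o ≡ α + o * 2
  rearrange = solve-∀

theorem12 : (n : ℕ) → 0 < n → (e o : ℕ) →
    HasCard (EH n) e → HasCard (EO n) o → o ≡ e / 2
theorem12 n n>0 e o card-EH card-EO with balanced n n>0
... | _ , c , graded , α , α≤1 , excess = begin
  o                         ≡⟨ card-unique card-EO (odd-hasse-count graded) ⟩
  c true                    ≡⟨ sym (half-of-near-double (c true) α α≤1) ⟩
  (c true + α + c true) / 2 ≡⟨ cong (λ z → (z + c true) / 2) (sym excess) ⟩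
  (c false + c true) / 2    ≡⟨ cong (_/ 2) (card-unique (hasse-count graded) card-EH) ⟩
  e / 2                     ∎
  where open ≡-Reasoning
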